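{- Let $Q$ be a set of analytic quasiequations and let $\mathsf K$ be the class of $*$-continuous action lattices satisfying every quasiequation in $Q$. Then $\mathsf K$ is closed under MacNeille completions: for every $\mathbf A\in\mathsf K$, the MacNeille completion $\overline{\mathbf A}$ of $\mathbf A$ belongs to $\mathsf K$.
   Context: An action lattice is an algebra $(A,\wedge,\vee,\cdot,\backslash,/,{}^*,0,1)$ such that $(A,\wedge,\vee)$ is a lattice with order $\le$, $(A,\cdot,1)$ is a monoid, $xy\le z\iff y\le x\backslash z\iff x\le z/y$ for all $x,y,z$, $0\le x$ for all $x$, and $1\vee xx^*\le x^*$, $xy\le y\Rightarrow x^*y\le y$, $yx\le y\Rightarrow yx^*\le y$. It is $*$-continuous if $a^*=\bigvee_{n\in\mathbb N}a^n$ for every $a$ (with $a^0=1$, $a^{n+1}=a^na$). An analytic quasiequation is one of the form $\alpha_1\le y\ \&\cdots\&\ \alpha_n\le y\implies\alpha_0\le y$ where $\alpha_0=x_1\cdots x_m$ for distinct variables $x_1,\dots,x_m$, $y$ is a variable distinct from them, and each $\alpha_i$ ($i\ge1$) is a product of variables among $x_1,\dots,x_m$ (the empty product being $1$). An algebra satisfies it if every assignment satisfying all premises satisfies the conclusion. MacNeille completion: for an action lattice $\mathbf A$ and $X\subseteq A$, let $X^u$ be the set of upper bounds and $X^l$ the set of lower bounds of $X$, and $\gamma(X)=X^{ul}$. The MacNeille completion $\overline{\mathbf A}$ has universe $\{X\subseteq A:\gamma(X)=X\}$ with operations $X\wedge Y=X\cap Y$, $X\vee Y=\gamma(X\cup Y)$,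 $X\cdot Y=\gamma(\{xy:x\in X,y\in Y\})$, $X\backslash Y=\{c: xc\in Y\text{ for all }x\in X\}$, $Y/X=\{c: cx\in Y\text{ for all }x\in X\}$, $X^*=\gamma(\{x_0\cdots x_{k-1}:k\in\mathbb N,\ x_i\in X\})$, constant $0$ interpreted as $\{a\in A: a\le 0\}$ and $1$ as $\gamma(\{1\})$; $\mathbf A$ embeds into it via $a\mapsto\{b:b\le a\}$. -}

module Defs where

open import Level using (Level; _⊔_; Lift; lift; lower) renaming (suc to lsuc)
open import Data.Nat using (ℕ; zero; suc)
open import Data.Fin using (Fin)
open import Data.List using (List; map; foldr; allFin)
open import Data.List.Relation.Unary.All using (All)
open import Data.Product using (Σ; Σ-syntax; _×_; _,_; proj₁; proj₂)
open import Data.Sum using (_⊎_)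
open import Relation.Binary.PropositionalEquality using (_≡_)
open import Relation.Binary.Structures using (IsPartialOrder)
open import Relation.Binary.Lattice.Structures using (IsLattice)
open import Algebra.Structures using (IsMonoid)

-- Signature of action lattices (x \ z, z / y, x ⋆ = x^*, 𝟘, 𝟙).
-- Equality is a setoid equality _≈_ (needed since the MacNeille
-- completion consists of subsets, compared extensionally).

record RawActionLattice (c ℓ₁ ℓ₂ : Level) : Set (lsuc (c ⊔ ℓ₁ ⊔ ℓ₂)) where
  infixl 7 _·_ _\\_ _//_
  infix 4 _≤_ _≈_
  infixl 6 _∧_ _∨_
  infix 8 _⋆
  field
    Carrier : Set c
    _≈_     : Carrier → Carrier → Set ℓ₁
    _≤_     : Carrier → Carrier → Set ℓ₂
    _∧_     : Carrier → Carrier → Carrier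
    _∨_     : Carrier → Carrier → Carrier
    _·_     : Carrier → Carrier → Carrier
    _\\_    : Carrier → Carrier → Carrier
    _//_    : Carrier → Carrier → Carrier
    _⋆      : Carrier → Carrier
    𝟘       : Carrier
    𝟙       : Carrier

record IsActionLattice {c ℓ₁ ℓ₂} (R : RawActionLattice c ℓ₁ ℓ₂)
       : Set (c ⊔ ℓ₁ ⊔ ℓ₂) where
  open RawActionLattice R
  field
    isLattice : IsLattice _≈_ _≤_ _∨_ _∧_
    isMonoid  : IsMonoid _≈_ _·_ 𝟙
    residualˡ : ∀ x y z → (x · y ≤ z → y ≤ x \\ z) × (y ≤ x \\ z → x · y ≤ z)
    residualʳ : ∀ x y z → (x · y ≤ z → x ≤ z // y) × (x ≤ z // y → x · y ≤ z)
    bottom    : ∀ x → 𝟘 ≤ x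
    star-unfold : ∀ x → (𝟙 ∨ (x · (x ⋆))) ≤ (x ⋆)
    star-indˡ : ∀ x y → x · y ≤ y → (x ⋆) · y ≤ y
    star-indʳ : ∀ x y → y · x ≤ y → y · (x ⋆) ≤ y

record ActionLattice (c ℓ₁ ℓ₂ : Level) : Set (lsuc (c ⊔ ℓ₁ ⊔ ℓ₂)) where
  field
    raw             : RawActionLattice c ℓ₁ ℓ₂
    isActionLattice : IsActionLattice raw
  open RawActionLattice raw public
  open IsActionLattice isActionLattice public

module _ {c ℓ₁ ℓ₂} (R : RawActionLattice c ℓ₁ ℓ₂) where
  open RawActionLattice R

  pow : Carrier → ℕ → Carrier
  pow a zero    = 𝟙
  pow a (suc n) = pow a n · a

  StarContinuous : Set (c ⊔ ℓ₂)
  StarContinuous = ∀ a →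
    (∀ n → pow a n ≤ (a ⋆)) × (∀ b → (∀ n → pow a n ≤ b) → (a ⋆) ≤ b)

  prod : List Carrier → Carrier
  prod = foldr _·_ 𝟙

-- Analytic quasiequations
--   α₁ ≤ y & ... & αₙ ≤ y ⇒ x₁ ⋯ xₘ ≤ y
-- The variables x₁,…,xₘ are the elements of Fin m; y is a separate
-- variable; each premise αᵢ is a word (list) over Fin m.

record AnalyticQE : Set where
  field
    m        : ℕ
    premises : List (List (Fin m))

module _ {c ℓ₁ ℓ₂} (R : RawActionLattice c ℓ₁ ℓ₂) where
  open RawActionLattice R

  Satisfies : AnalyticQE → Set (c ⊔ ℓ₂)
  Satisfies q = ∀ (v : Fin m → Carrier) (y : Carrier) →
      All (λ α → prod R (map v α) ≤ y) premises →
      prod R (map v (allFin m)) ≤ y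
    where open AnalyticQE q

  InK : ∀ {q} → (AnalyticQE → Set q) → Set (c ⊔ ℓ₁ ⊔ ℓ₂ ⊔ q)
  InK Q = IsActionLattice R × StarContinuous R × (∀ e → Q e → Satisfies e)

module MacNeilleConstruction {c ℓ₁ ℓ₂} (A : ActionLattice c ℓ₁ ℓ₂) where
  open ActionLattice A
  open IsPartialOrder (IsLattice.isPartialOrder isLattice)
    using () renaming (trans to ≤-trans)

  Sub : Set (lsuc (c ⊔ ℓ₂))
  Sub = Carrier → Set (c ⊔ ℓ₂)

  _⊆_ : Sub → Sub → Set (c ⊔ ℓ₂)
  X ⊆ Y = ∀ a → X a → Y a

  up : Sub → Sub
  up X b = Lift c (∀ x → X x → x ≤ b)

  low : Sub → Sub
  low X a = Lift c (∀ b → X b → a ≤ b)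

  γ : Sub → Sub
  γ X = low (up X)

  Closed : Sub → Set (c ⊔ ℓ₂)
  Closed X = γ X ⊆ X

  Elem : Set (lsuc (c ⊔ ℓ₂))
  Elem = Σ Sub Closed

  γ-closed : ∀ X → Closed (γ X)
  γ-closed X a (lift h) =
    lift λ b (lift u) → h b (lift λ d (lift dγ) → dγ b (lift u))

  ∩ : Sub → Sub → Sub
  ∩ X Y a = X a × Y a

  ∪ : Sub → Sub → Sub
  ∪ X Y a = X a ⊎ Y a

  products : Sub → Sub → Sub
  products X Y z = Σ[ x ∈ Carrier ] Σ[ y ∈ Carrier ] (X x × Y y × z ≡ x · y)

  words : Sub → Sub
  words X z = Σ[ xs ∈ List Carrier ] (All X xs × z ≡ prod raw xs)

  single : Carrier → Sub
  single u z = Lift ℓ₂ (z ≡ u)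

  ldiv : Sub → Sub → Sub
  ldiv X Y a = ∀ x → X x → Y (x · a)

  rdiv : Sub → Sub → Sub
  rdiv Y X a = ∀ x → X x → Y (a · x)

  zeroSet : Sub
  zeroSet a = Lift c (a ≤ 𝟘)

  ∩-closed : ∀ X Y → Closed X → Closed Y → Closed (∩ X Y)
  ∩-closed X Y cX cY a (lift h) =
      cX a (lift λ b (lift u) → h b (lift λ x xy → u x (proj₁ xy)))
    , cY a (lift λ b (lift u) → h b (lift λ x xy → u x (proj₂ xy)))

  ldiv-closed : ∀ X Y → Closed Y → Closed (ldiv X Y)
  ldiv-closed X Y cY a (lift h) x xX = cY (x · a) (lift λ b (lift u) →
    proj₂ (residualˡ x a b)
      (h (x \\ b) (lift λ d dd →
         proj₁ (residualˡ x d b) (u (x · d) (dd x xX)))))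

  rdiv-closed : ∀ Y X → Closed Y → Closed (rdiv Y X)
  rdiv-closed Y X cY a (lift h) x xX = cY (a · x) (lift λ b (lift u) →
    proj₂ (residualʳ a x b)
      (h (b // x) (lift λ d dd →
         proj₁ (residualʳ d x b) (u (d · x) (dd x xX)))))

  zero-closed : Closed zeroSet
  zero-closed a (lift h) = lift (h 𝟘 (lift λ x xz → lower xz))

  completion : RawActionLattice (lsuc (c ⊔ ℓ₂)) (c ⊔ ℓ₂) (c ⊔ ℓ₂)
  completion = record
    { Carrier = Elem
    ; _≈_  = λ X Y → (proj₁ X ⊆ proj₁ Y) × (proj₁ Y ⊆ proj₁ X)
    ; _≤_  = λ X Y → proj₁ X ⊆ proj₁ Y
    ; _∧_  = λ X Y → ∩ (proj₁ X) (proj₁ Y)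
                   , ∩-closed (proj₁ X) (proj₁ Y) (proj₂ X) (proj₂ Y)
    ; _∨_  = λ X Y → γ (∪ (proj₁ X) (proj₁ Y)) , γ-closed _
    ; _·_  = λ X Y → γ (products (proj₁ X) (proj₁ Y)) , γ-closed _
    ; _\\_ = λ X Y → ldiv (proj₁ X) (proj₁ Y)
                   , ldiv-closed (proj₁ X) (proj₁ Y) (proj₂ Y)
    ; _//_ = λ Y X → rdiv (proj₁ Y) (proj₁ X)
                   , rdiv-closed (proj₁ Y) (proj₁ X) (proj₂ Y)
    ; _⋆   = λ X → γ (words (proj₁ X)) , γ-closed _
    ; 𝟘    = zeroSet , zero-closed
    ; 𝟙    = γ (single 𝟙) , γ-closed _
    }

MacNeille : ∀ {c ℓ₁ ℓ₂} → ActionLattice c ℓ₁ ℓ₂ →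
            RawActionLattice (lsuc (c ⊔ ℓ₂)) (c ⊔ ℓ₂) (c ⊔ ℓ₂)
MacNeille A = MacNeilleConstruction.completion A

-- The operations of the completion are those induced by the closure operator γ, so every law
-- reduces to the fact that the residuals Z / T and S \ Z of a closed set Z are again closed:
-- an inclusion S ⊆ Z / T of generators therefore extends to γ S ⊆ Z / T.  The star of X is
-- generated by the finite products of elements of X, which makes the completion *-continuous
-- outright, and a product X₁ ⋯ Xₘ is generated by the products x₁ ⋯ xₘ of representatives.
-- Since the variables of an analytic quasiequation are distinct, the representatives can be
-- chosen independently, and the quasiequation in the completion reduces to its instances in A.
module Submission where

open import Defs
open import Level using (_⊔_; lift; lower)
open import Function using (id)
open import Data.Nat using (ℕ; zero; suc)
open import Data.Fin using (Fin; zero; suc)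
open import Data.List using ([]; _∷_; _∷ʳ_; map; tabulate)
open import Data.List.Properties using (map-tabulate)
open import Data.List.Relation.Unary.All as All using (All; []; _∷_)
open import Data.List.Relation.Unary.All.Properties using (∷ʳ⁺)
open import Data.Product using (Σ; _×_; _,_; proj₁; proj₂)
open import Data.Sum using (inj₁; inj₂)
open import Relation.Binary.PropositionalEquality using (refl; sym; subst)
open import Relation.Binary.Structures using (IsEquivalence; IsPartialOrder)
open import Relation.Binary.Lattice.Structures using (IsLattice)
open import Algebra.Structures using (IsMonoid)

module Completion {c ℓ₁ ℓ₂} (A : ActionLattice c ℓ₁ ℓ₂) where
  open ActionLattice A
  open MacNeilleConstruction A
  open IsPartialOrder (IsLattice.isPartialOrder isLattice) using ()
    renaming (trans to ≤-trans; reflexive to ≤-reflexive)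
  open IsMonoid isMonoid using (∙-cong; assoc; identityˡ; identityʳ)
    renaming (refl to ≈-refl; sym to ≈-sym; trans to ≈-trans)

  module C = RawActionLattice completion

  ⟦_⟧ : Elem → Sub
  ⟦_⟧ = proj₁

  private variable
    S T Z M : Sub
    a b s t : Carrier

  γ-inflationary : S ⊆ γ S
  γ-inflationary a sa = lift λ b (lift ub) → ub a sa

  γ-least : S ⊆ Z → Closed Z → γ S ⊆ Z
  γ-least S⊆Z closedZ a (lift lb) =
    closedZ a (lift λ b (lift ub) → lb b (lift λ s sS → ub s (S⊆Z s sS)))

  γ-mono : S ⊆ T → γ S ⊆ γ T
  γ-mono S⊆T = γ-least (λ a sa → γ-inflationary a (S⊆T a sa)) (γ-closed _)

  closed-downward : Closed Z → a ≤ b → Z b → Z a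
  closed-downward closedZ a≤b Zb =
    closedZ _ (lift λ u (lift ub) → ≤-trans a≤b (ub _ Zb))

  closed-resp-≈ : Closed Z → a ≈ b → Z b → Z a
  closed-resp-≈ closedZ a≈b = closed-downward closedZ (≤-reflexive a≈b)

  product-∈ : S s → T t → γ (products S T) (s · t)
  product-∈ sS tT = γ-inflationary _ (_ , _ , sS , tT , refl)

  products-⊆ʳ : Closed Z → S ⊆ rdiv Z T → γ (products S T) ⊆ Z
  products-⊆ʳ closedZ S⊆Z/T =
    γ-least (λ { _ (s , t , sS , tT , refl) → S⊆Z/T s sS t tT }) closedZ

  products-⊆ˡ : Closed Z → T ⊆ ldiv S Z → γ (products S T) ⊆ Z
  products-⊆ˡ closedZ T⊆S\Z = products-⊆ʳ closedZ λ s sS t tT → T⊆S\Z t tT s sS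

  products-γˡ-⊆ : Closed Z → S ⊆ rdiv Z T → γ (products (γ S) T) ⊆ Z
  products-γˡ-⊆ closedZ S⊆Z/T =
    products-⊆ʳ closedZ (γ-least S⊆Z/T (rdiv-closed _ _ closedZ))

  products-γʳ-⊆ : Closed Z → T ⊆ ldiv S Z → γ (products S (γ T)) ⊆ Z
  products-γʳ-⊆ closedZ T⊆S\Z =
    products-⊆ˡ closedZ (γ-least T⊆S\Z (ldiv-closed _ _ closedZ))

  ≈-isEquivalence : IsEquivalence C._≈_
  ≈-isEquivalence = record
    { refl  = (λ _ x → x) , (λ _ x → x)
    ; sym   = λ (X⊆Y , Y⊆X) → Y⊆X , X⊆Y
    ; trans = λ (X⊆Y , Y⊆X) (Y⊆Z , Z⊆Y) →
        (λ a x → Y⊆Z a (X⊆Y a x)) , (λ a z → Y⊆X a (Z⊆Y a z))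
    }

  ≤-isPartialOrder : IsPartialOrder C._≈_ C._≤_
  ≤-isPartialOrder = record
    { isPreorder = record
      { isEquivalence = ≈-isEquivalence
      ; reflexive     = proj₁
      ; trans         = λ X⊆Y Y⊆Z a x → Y⊆Z a (X⊆Y a x)
      }
    ; antisym = _,_
    }

  isLattice-completion : IsLattice C._≈_ C._≤_ C._∨_ C._∧_
  isLattice-completion = record
    { isPartialOrder = ≤-isPartialOrder
    ; supremum = λ X Y →
          (λ a x → γ-inflationary a (inj₁ x))
        , (λ a y → γ-inflationary a (inj₂ y))
        , λ Z X⊆Z Y⊆Z → γ-least (λ { a (inj₁ x) → X⊆Z a x ; a (inj₂ y) → Y⊆Z a y }) (proj₂ Z)
    ; infimum = λ X Y → (λ _ → proj₁) , (λ _ → proj₂) , λ Z Z⊆X Z⊆Y a z → Z⊆X a z , Z⊆Y a z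
    }

  ·-assoc-⊆ : ∀ X Y Z → ⟦ (X C.· Y) C.· Z ⟧ ⊆ ⟦ X C.· (Y C.· Z) ⟧
  ·-assoc-⊆ X Y Z = products-γˡ-⊆ (γ-closed _)
    λ { _ (x , y , xX , yY , refl) z zZ →
      closed-resp-≈ (γ-closed _) (assoc x y z) (product-∈ xX (product-∈ yY zZ)) }

  ·-assoc-⊇ : ∀ X Y Z → ⟦ X C.· (Y C.· Z) ⟧ ⊆ ⟦ (X C.· Y) C.· Z ⟧
  ·-assoc-⊇ X Y Z = products-γʳ-⊆ (γ-closed _)
    λ { _ (y , z , yY , zZ , refl) x xX →
      closed-resp-≈ (γ-closed _) (≈-sym (assoc x y z)) (product-∈ (product-∈ xX yY) zZ) }

  𝟙-∈ : ⟦ C.𝟙 ⟧ 𝟙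
  𝟙-∈ = γ-inflationary _ (lift refl)

  isMonoid-completion : IsMonoid C._≈_ C._·_ C.𝟙
  isMonoid-completion = record
    { isSemigroup = record
      { isMagma = record
        { isEquivalence = ≈-isEquivalence
        ; ∙-cong = λ (X⊆X′ , X′⊆X) (Y⊆Y′ , Y′⊆Y) →
            γ-mono (products-mono X⊆X′ Y⊆Y′) , γ-mono (products-mono X′⊆X Y′⊆Y)
        }
      ; assoc = λ X Y Z → ·-assoc-⊆ X Y Z , ·-assoc-⊇ X Y Z
      }
    ; identity =
        (λ X → products-γˡ-⊆ (proj₂ X) (λ { _ (lift refl) x xX →
                 closed-resp-≈ (proj₂ X) (identityˡ x) xX })
             , λ x xX → closed-resp-≈ (γ-closed _) (≈-sym (identityˡ x)) (product-∈ 𝟙-∈ xX))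
      , (λ X → products-γʳ-⊆ (proj₂ X) (λ { _ (lift refl) x xX →
                 closed-resp-≈ (proj₂ X) (identityʳ x) xX })
             , λ x xX → closed-resp-≈ (γ-closed _) (≈-sym (identityʳ x)) (product-∈ xX 𝟙-∈))
    }
    where
    products-mono : ∀ {S S′ T T′} → S ⊆ S′ → T ⊆ T′ → products S T ⊆ products S′ T′
    products-mono S⊆S′ T⊆T′ z (s , t , sS , tT , z≡st) = s , t , S⊆S′ s sS , T⊆T′ t tT , z≡st

  IsSubmonoid : Sub → Set (c ⊔ ℓ₂)
  IsSubmonoid M = M 𝟙 × (∀ {a b} → M a → M b → M (a · b))

  words-⊆ : IsSubmonoid M → S ⊆ M → words S ⊆ M
  words-⊆ {M = M} {S = S} (M𝟙 , M·) S⊆M _ (xs , Sxs , refl) = go xs Sxs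
    where
    go : ∀ xs → All S xs → M (prod raw xs)
    go []       []         = M𝟙
    go (x ∷ xs) (Sx ∷ Sxs) = M· (S⊆M x Sx) (go xs Sxs)

  rdiv-self-isSubmonoid : Closed Z → IsSubmonoid (rdiv Z Z)
  rdiv-self-isSubmonoid closedZ =
      (λ z Zz → closed-resp-≈ closedZ (identityˡ z) Zz)
    , λ {a} {b} Z/Za Z/Zb z Zz →
        closed-resp-≈ closedZ (assoc a b z) (Z/Za _ (Z/Zb z Zz))

  ldiv-self-isSubmonoid : Closed Z → IsSubmonoid (ldiv Z Z)
  ldiv-self-isSubmonoid closedZ =
      (λ z Zz → closed-resp-≈ closedZ (identityʳ z) Zz)
    , λ {a} {b} Z\Za Z\Zb z Zz →
        closed-resp-≈ closedZ (≈-sym (assoc z a b)) (Z\Zb _ (Z\Za z Zz))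

  isActionLattice-completion : IsActionLattice completion
  isActionLattice-completion = record
    { isLattice = isLattice-completion
    ; isMonoid  = isMonoid-completion
    ; residualˡ = λ X Y Z →
          (λ XY⊆Z y yY x xX → XY⊆Z _ (product-∈ xX yY))
        , products-⊆ˡ (proj₂ Z)
    ; residualʳ = λ X Y Z →
          (λ XY⊆Z x xX y yY → XY⊆Z _ (product-∈ xX yY))
        , products-⊆ʳ (proj₂ Z)
    ; bottom = λ X a a≤𝟘 → closed-downward (proj₂ X) (lower a≤𝟘) (bottom-∈ X)
    ; star-unfold = λ X → γ-least
        (λ { a (inj₁ 𝟙a)  → γ-mono (λ { _ (lift refl) → [] , [] , refl }) a 𝟙a
           ; a (inj₂ XX⋆a) → products-γʳ-⊆ (γ-closed _)
               (λ { _ (xs , Xxs , refl) x xX → γ-inflationary _ (x ∷ xs , xX ∷ Xxs , refl) })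
               a XX⋆a })
        (γ-closed _)
    ; star-indˡ = λ X Y XY⊆Y → products-γˡ-⊆ (proj₂ Y)
        (words-⊆ (rdiv-self-isSubmonoid (proj₂ Y)) λ x xX y yY → XY⊆Y _ (product-∈ xX yY))
    ; star-indʳ = λ X Y YX⊆Y → products-γʳ-⊆ (proj₂ Y)
        (words-⊆ (ldiv-self-isSubmonoid (proj₂ Y)) λ x xX y yY → YX⊆Y _ (product-∈ yY xX))
    }
    where
    bottom-∈ : ∀ X → ⟦ X ⟧ 𝟘
    bottom-∈ X = proj₂ X 𝟘 (lift λ b _ → bottom b)

  prod-∷ʳ : ∀ xs x → prod raw (xs ∷ʳ x) ≈ prod raw xs · x
  prod-∷ʳ []       x = ≈-trans (identityʳ x) (≈-sym (identityˡ x))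
  prod-∷ʳ (y ∷ xs) x =
    ≈-trans (∙-cong ≈-refl (prod-∷ʳ xs x)) (≈-sym (assoc y (prod raw xs) x))

  pow-⊆-⋆ : ∀ X n → ⟦ pow completion X n ⟧ ⊆ ⟦ X C.⋆ ⟧
  pow-⊆-⋆ X zero    = γ-mono (λ { _ (lift refl) → [] , [] , refl })
  pow-⊆-⋆ X (suc n) = products-⊆ʳ (γ-closed _) λ p p∈Xⁿ →
    γ-least words-·-X (rdiv-closed _ _ (γ-closed _)) p (pow-⊆-⋆ X n p p∈Xⁿ)
    where
    words-·-X : words ⟦ X ⟧ ⊆ rdiv (γ (words ⟦ X ⟧)) ⟦ X ⟧
    words-·-X _ (xs , Xxs , refl) x xX = closed-resp-≈ (γ-closed _) (≈-sym (prod-∷ʳ xs x))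
      (γ-inflationary _ (xs ∷ʳ x , ∷ʳ⁺ Xxs xX , refl))

  pow-·-word-∈ : ∀ X {n p} xs → All ⟦ X ⟧ xs → ⟦ pow completion X n ⟧ p →
                 Σ ℕ λ k → ⟦ pow completion X k ⟧ (p · prod raw xs)
  pow-·-word-∈ X {n} []       []         p∈Xⁿ =
    n , closed-resp-≈ (proj₂ (pow completion X n)) (identityʳ _) p∈Xⁿ
  pow-·-word-∈ X {n} (x ∷ xs) (xX ∷ Xxs) p∈Xⁿ =
    let k , pxxs∈Xᵏ = pow-·-word-∈ X {suc n} xs Xxs (product-∈ p∈Xⁿ xX)
    in  k , closed-resp-≈ (proj₂ (pow completion X k)) (≈-sym (assoc _ x _)) pxxs∈Xᵏ

  starContinuous-completion : StarContinuous completion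
  starContinuous-completion X = pow-⊆-⋆ X , λ B pow⊆B → γ-least
    (λ { _ (xs , Xxs , refl) →
      let k , xs∈Xᵏ = pow-·-word-∈ X {zero} xs Xxs 𝟙-∈
      in  closed-resp-≈ (proj₂ B) (≈-sym (identityˡ _)) (pow⊆B k _ xs∈Xᵏ) })
    (proj₂ B)

  prod-map-∈ : ∀ {I : Set} (v : I → Elem) (u : I → Carrier) → (∀ i → ⟦ v i ⟧ (u i)) →
               ∀ α → ⟦ prod completion (map v α) ⟧ (prod raw (map u α))
  prod-map-∈ v u u∈v []      = 𝟙-∈
  prod-map-∈ v u u∈v (i ∷ α) = product-∈ (u∈v i) (prod-map-∈ v u u∈v α)

  prod-tabulate-⊆ : ∀ {n} (v : Fin n → Elem) → Closed Z →
                    (∀ u → (∀ i → ⟦ v i ⟧ (u i)) → Z (prod raw (tabulate u))) →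
                    ⟦ prod completion (tabulate v) ⟧ ⊆ Z
  prod-tabulate-⊆ {n = zero}  v closedZ Z∋prods =
    γ-least (λ { _ (lift refl) → Z∋prods (λ ()) (λ ()) }) closedZ
  prod-tabulate-⊆ {n = suc n} v closedZ Z∋prods = products-⊆ʳ closedZ λ x x∈v₀ t t∈vs →
    prod-tabulate-⊆ (λ i → v (suc i)) (ldiv-closed (single x) _ closedZ)
      (λ u u∈vs → λ { _ (lift refl) →
        Z∋prods (λ { zero → x ; (suc i) → u i }) (λ { zero → x∈v₀ ; (suc i) → u∈vs i }) })
      t t∈vs x (lift refl)

  satisfies-completion : ∀ e → Satisfies raw e → Satisfies completion e
  satisfies-completion e satisfies v Y premises≤Y =
    subst (λ Xs → ⟦ prod completion Xs ⟧ ⊆ ⟦ Y ⟧) (sym (map-tabulate id v))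
      (prod-tabulate-⊆ v (proj₂ Y) λ u u∈v → proj₂ Y _ (lift λ b (lift Y≤b) →
        subst (λ xs → prod raw xs ≤ b) (map-tabulate id u)
          (satisfies u b (All.map (λ {α} α≤Y → Y≤b _ (α≤Y _ (prod-map-∈ v u u∈v α))) premises≤Y))))

mainTheorem3 : ∀ {c ℓ₁ ℓ₂ q} (Q : AnalyticQE → Set q) (A : ActionLattice c ℓ₁ ℓ₂) →
    InK (ActionLattice.raw A) Q →
    InK (MacNeille A) Q
mainTheorem3 Q A (_ , _ , satisfiesQ) =
    isActionLattice-completion
  , starContinuous-completion
  , λ e Qe → satisfies-completion e (satisfiesQ e Qe)
  where open Completion A
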